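{- Let $\Gamma$ be a $G$-symmetric graph, $N$ a group, $\rho:G\to\mathrm{Aut}(N)$ a homomorphism, and $\phi:A\Gamma\to N$ an $N$-chain compatible with $\rho$. Then the Biggs cover $\widetilde{\Gamma}(N,\rho,\phi)$ is $(N\rtimes_\rho G)$-symmetric, i.e. the semidirect product $N\rtimes_\rho G$ acts on $\widetilde{\Gamma}(N,\rho,\phi)$ by automorphisms transitively on its vertices and on its arcs.
   Context: A graph is $G$-symmetric if $G$ acts on it by automorphisms transitively on vertices and on arcs (ordered pairs of adjacent vertices); $A\Gamma$ denotes the arc set of $\Gamma$. An $N$-chain is a map $\phi:A\Gamma\to N$ with $\phi((v,u))=\phi((u,v))^{ -1}$ for all $(u,v)\in A\Gamma$. It is compatible with $\rho$ if $\phi((u,v)^g)=\phi((u,v))^{\rho(g)}$ for all $g\in G$ and $(u,v)\in A\Gamma$, where $(u,v)^g=(u^g,v^g)$. The Biggs cover $\widetilde{\Gamma}(N,\rho,\phi)$ has vertex set $\{(n,v):n\in N, v\in V\Gamma\}$ and arc set $\{((n_1,v_1),(n_2,v_2)):(v_1,v_2)\in A\Gamma,\ n_2=n_1\phi((v_1,v_2))\}$. $N\rtimes_\rho G$ is the semidirect product of $N$ by $G$ with respect to $\rho$. -}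

module Defs where

open import Level using (Level; _⊔_) renaming (suc to lsuc)
open import Algebra.Bundles using (Group)
open import Relation.Binary.Bundles using (Setoid)
open import Relation.Binary.Core using (Rel)
open import Data.Product using (Σ; ∃; _×_; _,_)
open import Data.Product.Relation.Binary.Pointwise.NonDependent using (×-setoid)
open import Function.Bundles using (_⇔_)
open import Relation.Nullary using (¬_)

private
  variable
    a ℓ e g ℓg n ℓn h ℓh : Level

-- Graphs: a vertex setoid with a symmetric, irreflexive adjacency
-- relation respecting vertex equality.  Arcs are ordered pairs (u , v)
-- together with a proof of adjacency.

record Graph (a ℓ e : Level) : Set (lsuc (a ⊔ ℓ ⊔ e)) where
  field
    VSetoid : Setoid a ℓ
  open Setoid VSetoid public
    using ()
    renaming (Carrier to Vertex; _≈_ to _≈ᵥ_)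
  field
    Adj        : Vertex → Vertex → Set e
    Adj-resp   : ∀ {u u′ v v′} → u ≈ᵥ u′ → v ≈ᵥ v′ → Adj u v → Adj u′ v′
    Adj-sym    : ∀ {u v} → Adj u v → Adj v u
    Adj-irrefl : ∀ {u v} → u ≈ᵥ v → ¬ Adj u v

record IsRightAction {H : Set h} (_≈H_ : Rel H ℓh) (_·_ : H → H → H) (ε : H)
                     (S : Setoid a ℓ) (act : Setoid.Carrier S → H → Setoid.Carrier S)
                     : Set (h ⊔ ℓh ⊔ a ⊔ ℓ) where
  open Setoid S
  field
    act-cong : ∀ {x y p q} → x ≈ y → p ≈H q → act x p ≈ act y q
    act-ε    : ∀ x → act x ε ≈ x
    act-·    : ∀ x p q → act x (p · q) ≈ act (act x p) q

record IsSymmetricAction {H : Set h} (_≈H_ : Rel H ℓh) (_·_ : H → H → H) (ε : H)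
                         (S : Setoid a ℓ) (Adj : Setoid.Carrier S → Setoid.Carrier S → Set e)
                         (act : Setoid.Carrier S → H → Setoid.Carrier S)
                         : Set (h ⊔ ℓh ⊔ a ⊔ ℓ ⊔ e) where
  open Setoid S
  field
    isAction         : IsRightAction _≈H_ _·_ ε S act
    byAutomorphisms  : ∀ p u v → Adj u v ⇔ Adj (act u p) (act v p)
    vertexTransitive : ∀ u v → ∃ λ p → act u p ≈ v
    arcTransitive    : ∀ u v u′ v′ → Adj u v → Adj u′ v′ →
                       ∃ λ p → (act u p ≈ u′) × (act v p ≈ v′)

IsGSymmetricVia : (G : Group g ℓg) (Γ : Graph a ℓ e)
                  → (Graph.Vertex Γ → Group.Carrier G → Graph.Vertex Γ) → Set _
IsGSymmetricVia G Γ act =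
  IsSymmetricAction (Group._≈_ G) (Group._∙_ G) (Group.ε G)
                    (Graph.VSetoid Γ) (Graph.Adj Γ) act

-- ρ : G → Aut(N) a homomorphism; automorphisms written exponentially,
-- n ↦ n ^ ρ(g) = ρ g n, composed left-to-right, so that
-- n ^ ρ(g h) = (n ^ ρ(g)) ^ ρ(h).

record IsAutHom (G : Group g ℓg) (N : Group n ℓn)
                (ρ : Group.Carrier G → Group.Carrier N → Group.Carrier N)
                : Set (g ⊔ ℓg ⊔ n ⊔ ℓn) where
  private
    module G = Group G
    module N = Group N
  field
    ρ-cong      : ∀ {x y p q} → x G.≈ y → p N.≈ q → ρ x p N.≈ ρ y q
    ρ-homo      : ∀ x p q → ρ x (p N.∙ q) N.≈ (ρ x p N.∙ ρ x q)
    ρ-injective : ∀ x p q → ρ x p N.≈ ρ x q → p N.≈ q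
    ρ-surjective : ∀ x q → ∃ λ p → ρ x p N.≈ q
    ρ-∙         : ∀ x y p → ρ (x G.∙ y) p N.≈ ρ y (ρ x p)

record IsNChain (Γ : Graph a ℓ e) (N : Group n ℓn)
                (φ : ∀ u v → Graph.Adj Γ u v → Group.Carrier N)
                : Set (a ⊔ ℓ ⊔ e ⊔ ℓn) where
  private
    module Γ = Graph Γ
    module N = Group N
  field
    φ-cong : ∀ {u u′ v v′} → u Γ.≈ᵥ u′ → v Γ.≈ᵥ v′ →
             (x : Γ.Adj u v) (y : Γ.Adj u′ v′) → φ u v x N.≈ φ u′ v′ y
    φ-inv  : ∀ u v (x : Γ.Adj u v) (y : Γ.Adj v u) → φ v u y N.≈ (φ u v x) N.⁻¹

IsCompatible : (G : Group g ℓg) (Γ : Graph a ℓ e) (N : Group n ℓn)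
               (act : Graph.Vertex Γ → Group.Carrier G → Graph.Vertex Γ)
               (ρ : Group.Carrier G → Group.Carrier N → Group.Carrier N)
               (φ : ∀ u v → Graph.Adj Γ u v → Group.Carrier N) → Set _
IsCompatible G Γ N act ρ φ =
  ∀ x u v (p : Graph.Adj Γ u v) (q : Graph.Adj Γ (act u x) (act v x)) →
  Group._≈_ N (φ (act u x) (act v x) q) (ρ x (φ u v p))

module Semidirect (G : Group g ℓg) (N : Group n ℓn)
                  (ρ : Group.Carrier G → Group.Carrier N → Group.Carrier N) where
  private
    module G = Group G
    module N = Group N

  SD : Set (n ⊔ g)
  SD = N.Carrier × G.Carrier

  _≈SD_ : Rel SD (ℓn ⊔ ℓg)
  (m , x) ≈SD (m′ , y) = (m N.≈ m′) × (x G.≈ y)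

  _·SD_ : SD → SD → SD
  (m , x) ·SD (m′ , y) = ((ρ y m) N.∙ m′ , x G.∙ y)

  εSD : SD
  εSD = (N.ε , G.ε)

module BiggsCover (Γ : Graph a ℓ e) (N : Group n ℓn)
                  (φ : ∀ u v → Graph.Adj Γ u v → Group.Carrier N) where
  private
    module Γ = Graph Γ
    module N = Group N

  CoverSetoid : Setoid (n ⊔ a) (ℓn ⊔ ℓ)
  CoverSetoid = ×-setoid N.setoid Γ.VSetoid

  CoverAdj : Setoid.Carrier CoverSetoid → Setoid.Carrier CoverSetoid → Set (e ⊔ ℓn)
  CoverAdj (n₁ , v₁) (n₂ , v₂) = Σ (Γ.Adj v₁ v₂) λ p → n₂ N.≈ (n₁ N.∙ φ v₁ v₂ p)

IsSDSymmetricCover : (G : Group g ℓg) (Γ : Graph a ℓ e) (N : Group n ℓn)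
                     (ρ : Group.Carrier G → Group.Carrier N → Group.Carrier N)
                     (φ : ∀ u v → Graph.Adj Γ u v → Group.Carrier N) → Set _
IsSDSymmetricCover G Γ N ρ φ =
  ∃ λ (act : Setoid.Carrier CoverSetoid → SD → Setoid.Carrier CoverSetoid) →
    IsSymmetricAction _≈SD_ _·SD_ εSD CoverSetoid CoverAdj act
  where
    open Semidirect G N ρ
    open BiggsCover Γ N φ

module Submission where

-- The fibres of the cover are copies of N and the adjacency n₂ = n₁ φ(v₁ , v₂) is defined by
-- right multiplication, so N acts on fibres by left division, while G acts on the base and
-- twists the fibre coordinate by ρ; compatibility of φ with ρ is exactly what makes the combined
-- action preserve adjacency.  Transitivity on vertices and arcs is inherited from G, because the
-- N-part can move any fibre point to any other and a lift of an arc is determined by its tail.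

open import Defs
open import Level using (Level)
open import Algebra.Bundles using (Group)
open import Data.Product using (∃; _×_; _,_)
open import Function.Bundles using (mk⇔; Equivalence)
open import Relation.Binary.Bundles using (Setoid)
import Algebra.Properties.Group as GroupProperties
import Relation.Binary.Reasoning.Setoid as SetoidReasoning

private
  variable
    g ℓg a ℓ e n ℓn : Level

module DivisionProperties {n ℓn} (N : Group n ℓn) where
  open Group N
  open GroupProperties N
  open SetoidReasoning setoid

  [x//y]\\x≈y : ∀ x y → (x // y) \\ x ≈ y
  [x//y]\\x≈y x y = begin
    (x // y) ⁻¹ ∙ x  ≈⟨ ∙-congʳ (⁻¹-anti-homo-// x y) ⟩
    (y // x) ∙ x     ≈⟨ //-rightDividesˡ x y ⟩
    y                ∎

  [x∙y]\\z≈y\\[x\\z] : ∀ x y z → (x ∙ y) \\ z ≈ y \\ (x \\ z)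
  [x∙y]\\z≈y\\[x\\z] x y z = begin
    (x ∙ y) ⁻¹ ∙ z       ≈⟨ ∙-congʳ (⁻¹-anti-homo-∙ x y) ⟩
    (y ⁻¹ ∙ x ⁻¹) ∙ z    ≈⟨ assoc (y ⁻¹) (x ⁻¹) z ⟩
    y ⁻¹ ∙ (x ⁻¹ ∙ z)    ∎

module MagmaHomomorphismOfGroups {h ℓh k ℓk} (H : Group h ℓh) (K : Group k ℓk)
    {f : Group.Carrier H → Group.Carrier K}
    (f-cong : ∀ {x y} → Group._≈_ H x y → Group._≈_ K (f x) (f y))
    (f-homo : ∀ x y → Group._≈_ K (f (Group._∙_ H x y)) (Group._∙_ K (f x) (f y))) where
  private
    module H = Group H
  open Group K
  open GroupProperties K
  open SetoidReasoning setoid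

  ε-homo : f H.ε ≈ ε
  ε-homo = ∙-cancelˡ (f H.ε) (f H.ε) ε (begin
    f H.ε ∙ f H.ε   ≈⟨ f-homo H.ε H.ε ⟨
    f (H.ε H.∙ H.ε) ≈⟨ f-cong (H.identityˡ H.ε) ⟩
    f H.ε           ≈⟨ identityʳ (f H.ε) ⟨
    f H.ε ∙ ε       ∎)

  ⁻¹-homo : ∀ x → f (x H.⁻¹) ≈ f x ⁻¹
  ⁻¹-homo x = inverseʳ-unique (f x) (f (x H.⁻¹)) (begin
    f x ∙ f (x H.⁻¹)  ≈⟨ f-homo x (x H.⁻¹) ⟨
    f (x H.∙ x H.⁻¹)  ≈⟨ f-cong (H.inverseʳ x) ⟩
    f H.ε             ≈⟨ ε-homo ⟩
    ε                 ∎)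

  \\-homo : ∀ x y → f (x H.\\ y) ≈ f x \\ f y
  \\-homo x y = begin
    f (x H.⁻¹ H.∙ y)   ≈⟨ f-homo (x H.⁻¹) y ⟩
    f (x H.⁻¹) ∙ f y   ≈⟨ ∙-congʳ (⁻¹-homo x) ⟩
    f x ⁻¹ ∙ f y       ∎

module AutHomProperties (G : Group g ℓg) (N : Group n ℓn)
    {ρ : Group.Carrier G → Group.Carrier N → Group.Carrier N} (aut : IsAutHom G N ρ) where
  private
    module G = Group G
  open Group N
  open IsAutHom aut
  open SetoidReasoning setoid

  ρ-identity : ∀ p → ρ G.ε p ≈ p
  ρ-identity p = ρ-injective G.ε _ _ (begin
    ρ G.ε (ρ G.ε p)    ≈⟨ ρ-∙ G.ε G.ε p ⟨
    ρ (G.ε G.∙ G.ε) p  ≈⟨ ρ-cong (G.identityˡ G.ε) refl ⟩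
    ρ G.ε p            ∎)

  ρ-\\ : ∀ x p q → ρ x (p \\ q) ≈ ρ x p \\ ρ x q
  ρ-\\ x = MagmaHomomorphismOfGroups.\\-homo N N (ρ-cong G.refl) (ρ-homo x)

module _ (Γ : Graph a ℓ e) (N : Group n ℓn)
    {φ : ∀ u v → Graph.Adj Γ u v → Group.Carrier N} (ch : IsNChain Γ N φ) where
  private
    module Γ = Graph Γ
  open Group N
  open IsNChain ch
  open BiggsCover Γ N φ
  open SetoidReasoning setoid

  CoverAdj-target-unique : ∀ {k k′ k₁ k₁′ u u′ v v′} → k ≈ k′ → u Γ.≈ᵥ u′ → v Γ.≈ᵥ v′ →
                           CoverAdj (k , u) (k₁ , v) → CoverAdj (k′ , u′) (k₁′ , v′) →
                           k₁ ≈ k₁′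
  CoverAdj-target-unique {k} {k′} {k₁} {k₁′} {u} {u′} {v} {v′} k≈k′ u≈u′ v≈v′ (p , k₁≈) (p′ , k₁′≈) =
    begin
      k₁               ≈⟨ k₁≈ ⟩
      k ∙ φ u v p      ≈⟨ ∙-cong k≈k′ (φ-cong u≈u′ v≈v′ p p′) ⟩
      k′ ∙ φ u′ v′ p′  ≈⟨ k₁′≈ ⟨
      k₁′              ∎

module CoverAction (G : Group g ℓg) (Γ : Graph a ℓ e) (N : Group n ℓn)
    {act : Graph.Vertex Γ → Group.Carrier G → Graph.Vertex Γ}
    {ρ : Group.Carrier G → Group.Carrier N → Group.Carrier N}
    {φ : ∀ u v → Graph.Adj Γ u v → Group.Carrier N}
    (sym : IsGSymmetricVia G Γ act) (aut : IsAutHom G N ρ)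
    (ch : IsNChain Γ N φ) (cmp : IsCompatible G Γ N act ρ φ) where
  private
    module G = Group G
    module Γ = Graph Γ
    module Sym = IsSymmetricAction sym
    module Act = IsRightAction Sym.isAction
  open Group N
  open GroupProperties N
  open DivisionProperties N
  open IsAutHom aut
  open IsNChain ch
  open AutHomProperties G N aut
  open Semidirect G N ρ
  open BiggsCover Γ N φ
  open SetoidReasoning setoid

  coverAct : Setoid.Carrier CoverSetoid → SD → Setoid.Carrier CoverSetoid
  coverAct (k , v) (m , x) = (m \\ ρ x k , act v x)

  coverAct-isRightAction : IsRightAction _≈SD_ _·SD_ εSD CoverSetoid coverAct
  coverAct-isRightAction = record
    { act-cong = λ (k≈ , v≈) (m≈ , x≈) → \\-cong₂ m≈ (ρ-cong x≈ k≈) , Act.act-cong v≈ x≈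
    ; act-ε    = λ (k , v) → (begin
        ε \\ ρ G.ε k  ≈⟨ \\-cong₂ refl (ρ-identity k) ⟩
        ε ⁻¹ ∙ k      ≈⟨ ∙-congʳ ε⁻¹≈ε ⟩
        ε ∙ k         ≈⟨ identityˡ k ⟩
        k             ∎) , Act.act-ε v
    ; act-·    = λ (k , v) (m , x) (m′ , y) → (begin
        (ρ y m ∙ m′) \\ ρ (x G.∙ y) k   ≈⟨ \\-cong₂ refl (ρ-∙ x y k) ⟩
        (ρ y m ∙ m′) \\ ρ y (ρ x k)     ≈⟨ [x∙y]\\z≈y\\[x\\z] (ρ y m) m′ _ ⟩
        m′ \\ (ρ y m \\ ρ y (ρ x k))    ≈⟨ \\-cong₂ refl (ρ-\\ y m (ρ x k)) ⟨
        m′ \\ ρ y (m \\ ρ x k)          ∎) , Act.act-· v x y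
    }

  imageArc : ∀ {u v} x → Γ.Adj u v → Γ.Adj (act u x) (act v x)
  imageArc {u} {v} x = Equivalence.to (Sym.byAutomorphisms x u v)

  ρ-∙-φ : ∀ {u v} x k (p : Γ.Adj u v) →
          ρ x (k ∙ φ u v p) ≈ ρ x k ∙ φ (act u x) (act v x) (imageArc x p)
  ρ-∙-φ {u} {v} x k p = begin
    ρ x (k ∙ φ u v p)      ≈⟨ ρ-homo x k (φ u v p) ⟩
    ρ x k ∙ ρ x (φ u v p)  ≈⟨ ∙-congˡ (cmp x u v p (imageArc x p)) ⟨
    ρ x k ∙ φ (act u x) (act v x) (imageArc x p)  ∎

  coverAct-preserves-CoverAdj : ∀ {k k′ u v} s → CoverAdj (k , u) (k′ , v) →
                                CoverAdj (coverAct (k , u) s) (coverAct (k′ , v) s)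
  coverAct-preserves-CoverAdj {k} {k′} {u} {v} (m , x) (p , k′≈) = imageArc x p , (begin
    m \\ ρ x k′                       ≈⟨ \\-cong₂ refl (ρ-cong G.refl k′≈) ⟩
    m \\ ρ x (k ∙ φ u v p)            ≈⟨ \\-cong₂ refl (ρ-∙-φ x k p) ⟩
    m \\ (ρ x k ∙ φ′)                 ≈⟨ assoc (m ⁻¹) (ρ x k) φ′ ⟨
    (m \\ ρ x k) ∙ φ′                 ∎)
    where φ′ = φ (act u x) (act v x) (imageArc x p)

  coverAct-reflects-CoverAdj : ∀ {k k′ u v} s →
                               CoverAdj (coverAct (k , u) s) (coverAct (k′ , v) s) →
                               CoverAdj (k , u) (k′ , v)
  coverAct-reflects-CoverAdj {k} {k′} {u} {v} (m , x) (q , k′≈) =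
    p , ρ-injective x k′ (k ∙ φ u v p) (∙-cancelˡ (m ⁻¹) _ _ (begin
      m \\ ρ x k′                ≈⟨ k′≈ ⟩
      (m \\ ρ x k) ∙ φ′ q        ≈⟨ ∙-congˡ (φ-cong Γ≈.refl Γ≈.refl q p′) ⟩
      (m \\ ρ x k) ∙ φ′ p′       ≈⟨ assoc (m ⁻¹) (ρ x k) (φ′ p′) ⟩
      m \\ (ρ x k ∙ φ′ p′)       ≈⟨ \\-cong₂ refl (ρ-∙-φ x k p) ⟨
      m \\ ρ x (k ∙ φ u v p)     ∎))
    where
      module Γ≈ = Setoid Γ.VSetoid
      p = Equivalence.from (Sym.byAutomorphisms x u v) q
      p′ = imageArc x p
      φ′ = φ (act u x) (act v x)

  coverAct-vertexTransitive : ∀ s t → ∃ λ r → Setoid._≈_ CoverSetoid (coverAct s r) t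
  coverAct-vertexTransitive (k , u) (k′ , v) =
    let (x , ux≈v) = Sym.vertexTransitive u v
    in (ρ x k // k′ , x) , [x//y]\\x≈y (ρ x k) k′ , ux≈v

  coverAct-arcTransitive : ∀ s t s′ t′ → CoverAdj s t → CoverAdj s′ t′ →
                           ∃ λ r → Setoid._≈_ CoverSetoid (coverAct s r) s′
                                 × Setoid._≈_ CoverSetoid (coverAct t r) t′
  coverAct-arcTransitive (k , u) (k₁ , v) (k′ , u′) (k₁′ , v′) s→t@(p , _) s′→t′@(p′ , _) =
    let (x , ux≈u′ , vx≈v′) = Sym.arcTransitive u v u′ v′ p p′
        r = (ρ x k // k′ , x)
        k≈k′ = [x//y]\\x≈y (ρ x k) k′
    in r , (k≈k′ , ux≈u′)
         , ( CoverAdj-target-unique Γ N ch k≈k′ ux≈u′ vx≈v′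
               (coverAct-preserves-CoverAdj r s→t) s′→t′
           , vx≈v′ )

  coverAct-isSymmetricAction : IsSymmetricAction _≈SD_ _·SD_ εSD CoverSetoid CoverAdj coverAct
  coverAct-isSymmetricAction = record
    { isAction         = coverAct-isRightAction
    ; byAutomorphisms  = λ r _ _ → mk⇔ (coverAct-preserves-CoverAdj r) (coverAct-reflects-CoverAdj r)
    ; vertexTransitive = coverAct-vertexTransitive
    ; arcTransitive    = coverAct-arcTransitive
    }

mainTheorem5 : ∀ {g ℓg a ℓ e n ℓn : Level}
    (G : Group g ℓg) (Γ : Graph a ℓ e) (N : Group n ℓn)
    (act : Graph.Vertex Γ → Group.Carrier G → Graph.Vertex Γ)
    (ρ : Group.Carrier G → Group.Carrier N → Group.Carrier N)
    (φ : ∀ u v → Graph.Adj Γ u v → Group.Carrier N) →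
    IsGSymmetricVia G Γ act →
    IsAutHom G N ρ →
    IsNChain Γ N φ →
    IsCompatible G Γ N act ρ φ →
    IsSDSymmetricCover G Γ N ρ φ
mainTheorem5 G Γ N act ρ φ sym aut ch cmp = coverAct , coverAct-isSymmetricAction
  where open CoverAction G Γ N sym aut ch cmp
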